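{- Let $w_1\le w_2$ be non-negative integers. Then the three sets $\mathcal{T}_{w_1,w_2}$, $\mathcal{T}^{lex}_{w_1,w_2}$ and $\mathcal{T}^{sub}_{w_1,w_2}$ (of affine equivalence classes of lattice triangles) are equal, where: $\mathcal{T}_{w_1,w_2}$ is the set of classes of lattice triangles $T$ with $\operatorname{width}^1(T)=w_1$ and $\operatorname{width}^2(T)=w_2$; $\mathcal{T}^{lex}_{w_1,w_2}$ is the set of classes of lattice triangles $T\subseteq[0,w_1]\times[0,w_2]$ such that for every pair $(w_1',w_2')$ strictly smaller than $(w_1,w_2)$ in lexicographic order, $T$ is not affine equivalent to a subset of $[0,w_1']\times[0,w_2']$; $\mathcal{T}^{sub}_{w_1,w_2}$ is the set of classes of lattice triangles $T\subseteq[0,w_1]\times[0,w_2]$ such that for every lattice point $(w_1',w_2')\in[0,w_1]\times[0,w_2]$, if $T$ is affine equivalent to a subset of $[0,w_1']\times[0,w_2']$ then $(w_1',w_2')=(w_1,w_2)$.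
   Context: A lattice triangle $T=T(v_1,v_2,v_3)$ is the convex hull of three points $v_1,v_2,v_3\in\mathbb{Z}^2$ (recorded as a multiset; degenerate triangles allowed). Affine equivalence is via maps $x\mapsto Ax+c$ with $A\in\mathrm{GL}_2(\mathbb{Z})$, $c\in\mathbb{Z}^2$ (mapping vertices to vertices). For $u\in(\mathbb{Z}^2)^*$, $\operatorname{width}_u(T)=\max_{x\in T}u\cdot x-\min_{x\in T}u\cdot x$. Choosing linearly independent $u_1,u_2\in(\mathbb{Z}^2)^*$ minimizing $(\operatorname{width}_{u_1}(T),\operatorname{width}_{u_2}(T))$ in lexicographic order, $\operatorname{width}^1(T)=\operatorname{width}_{u_1}(T)$ and $\operatorname{width}^2(T)=\operatorname{width}_{u_2}(T)$. Lexicographic order: $(a,b)<_{lex}(a',b')$ iff $a<a'$, or $a=a'$ and $b<b'$. -}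

module Defs where

open import Data.Integer using (ℤ; +_; _+_; _*_; _-_; _⊔_; _⊓_; _≤_; _<_; 0ℤ; 1ℤ; -1ℤ)
open import Data.Nat as ℕ using (ℕ)
open import Data.Fin using (Fin; zero; suc)
open import Data.Fin.Permutation using (Permutation′; _⟨$⟩ʳ_)
open import Data.Product using (_×_; _,_; Σ; ∃; ∃-syntax)
open import Data.Sum using (_⊎_)
open import Relation.Nullary using (¬_)
open import Relation.Binary.PropositionalEquality using (_≡_)
open import Function.Bundles using (_⇔_)

Point : Set
Point = ℤ × ℤ

Dual : Set
Dual = ℤ × ℤ

-- A lattice triangle, recorded by its three vertices (degenerate allowed).
Triangle : Set
Triangle = Fin 3 → Point

_·_ : Dual → Point → ℤ
(a , b) · (x , y) = a * x + b * y

record Mat2 : Set where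
  constructor mat
  field
    a b c d : ℤ

det : Mat2 → ℤ
det (mat a b c d) = a * d - b * c

InGL2Z : Mat2 → Set
InGL2Z A = det A ≡ 1ℤ ⊎ det A ≡ -1ℤ

apply : Mat2 → Point → Point → Point
apply (mat a b c d) (t₁ , t₂) (x , y) = (a * x + b * y + t₁ , c * x + d * y + t₂)

AffEquiv : Triangle → Triangle → Set
AffEquiv T T' = Σ Mat2 λ A → InGL2Z A × Σ Point λ t → Σ (Permutation′ 3) λ σ →
  ∀ i → apply A t (T i) ≡ T' (σ ⟨$⟩ʳ i)

-- width_u(T) = max_{x∈T} u·x − min_{x∈T} u·x (extrema of a linear
-- functional over the convex hull are attained at vertices).
maxV minV : Dual → Triangle → ℤ
maxV u T = (u · T zero) ⊔ ((u · T (suc zero)) ⊔ (u · T (suc (suc zero))))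
minV u T = (u · T zero) ⊓ ((u · T (suc zero)) ⊓ (u · T (suc (suc zero))))

width : Dual → Triangle → ℤ
width u T = maxV u T - minV u T

LinIndep : Dual → Dual → Set
LinIndep (a , b) (c , d) = ¬ (a * d - b * c ≡ 0ℤ)

_<lex_ : ℤ × ℤ → ℤ × ℤ → Set
(a , b) <lex (a' , b') = a < a' ⊎ (a ≡ a' × b < b')

_≤lex_ : ℤ × ℤ → ℤ × ℤ → Set
p ≤lex q = p <lex q ⊎ p ≡ q

_<lexℕ_ : ℕ × ℕ → ℕ × ℕ → Set
(a , b) <lexℕ (a' , b') = a ℕ.< a' ⊎ (a ≡ a' × b ℕ.< b')

-- (width¹(T), width²(T)) = (w₁ , w₂): the lexicographic minimum of
-- (width_{u₁}(T), width_{u₂}(T)) over linearly independent u₁ , u₂ is (w₁ , w₂).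
HasWidths : Triangle → ℤ → ℤ → Set
HasWidths T w₁ w₂ =
  (Σ Dual λ u₁ → Σ Dual λ u₂ → LinIndep u₁ u₂ × width u₁ T ≡ w₁ × width u₂ T ≡ w₂)
  × (∀ u₁ u₂ → LinIndep u₁ u₂ → (w₁ , w₂) ≤lex (width u₁ T , width u₂ T))

-- T ⊆ [0,w₁]×[0,w₂]  (the box is convex, so it suffices that the vertices lie in it)
InBox : Triangle → ℕ → ℕ → Set
InBox T w₁ w₂ = ∀ i → let (x , y) = T i in
  (0ℤ ≤ x × x ≤ + w₁) × (0ℤ ≤ y × y ≤ + w₂)

EquivToSubBox : Triangle → ℕ → ℕ → Set
EquivToSubBox T w₁ w₂ = Σ Triangle λ T' → AffEquiv T T' × InBox T' w₁ w₂

InT : ℕ → ℕ → Triangle → Set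
InT w₁ w₂ T = HasWidths T (+ w₁) (+ w₂)

InTlex : ℕ → ℕ → Triangle → Set
InTlex w₁ w₂ T = Σ Triangle λ T' → AffEquiv T T' × InBox T' w₁ w₂ ×
  (∀ w₁' w₂' → (w₁' , w₂') <lexℕ (w₁ , w₂) → ¬ EquivToSubBox T' w₁' w₂')

InTsub : ℕ → ℕ → Triangle → Set
InTsub w₁ w₂ T = Σ Triangle λ T' → AffEquiv T T' × InBox T' w₁ w₂ ×
  (∀ w₁' w₂' → w₁' ℕ.≤ w₁ → w₂' ℕ.≤ w₂ → EquivToSubBox T' w₁' w₂' →
     (w₁' ≡ w₁ × w₂' ≡ w₂))

{-# OPTIONS --safe #-}

-- A triangle is affinely equivalent to a subset of [0,a]×[0,b] exactly when some unimodular
-- pair of directions u₁, u₂ has width_{u₁} ≤ a and width_{u₂} ≤ b.  Linear independence of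
-- u₁, u₂ already suffices: if N = |det(u₁,u₂)| > 1, some lattice vector lies outside the span
-- of u₁, u₂; reducing it modulo that sublattice gives z with N z = α u₁ + β u₂, where
-- |α|, |β| ≤ N/2 and (α, β) ≠ 0.  Then N·width_z ≤ |α| a + |β| b, so z can replace one of
-- u₁, u₂ keeping the bounds, and the determinant drops to |α| or |β| < N.
-- Consequently all three sets consist of the triangles whose lexicographically smallest
-- fitting box is w₁ × w₂; for the third one, a box a × b with a < w₁ and the box w₁ × w₂
-- combine into a box a × w₂, using w₁ ≤ w₂.

module Submission where

open import Defs
open import Data.Nat using (ℕ; _≤_)
open import Data.Product using (_×_)
open import Function.Bundles using (_⇔_)

open import Algebra.Core using (Op₂)
open import Algebra.Definitions using (Selective)
open import Data.Empty using (⊥-elim)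
open import Data.Fin using (Fin; zero; suc)
open import Data.Fin.Permutation using (_⟨$⟩ʳ_; _⟨$⟩ˡ_; inverseʳ)
import Data.Fin.Permutation as Permutation
open import Data.Integer
  using (ℤ; +_; -[1+_]; _+_; _*_; _-_; -_; ∣_∣; _⊓_; _⊔_; 0ℤ; 1ℤ; -1ℤ; +≤+; -≤+; +<+; ≢-nonZero)
  renaming (_≤_ to _≤ℤ_)
open import Data.Integer.DivMod using (_%ℕ_; _/ℕ_; a≡a%ℕn+[a/ℕn]*n; n%ℕd<d)
open import Data.Integer.Divisibility.Signed
  using (_∣_; divides; _∣?_; ∣⇒∣ᵤ; ∣-trans; ∣m∣n⇒∣m-n; *-monoʳ-∣; *-monoˡ-∣; *-cancelˡ-∣)
import Data.Integer.Properties as ℤ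
open import Data.Integer.Tactic.RingSolver using (solve-∀)
import Data.Nat as ℕ
open import Data.Nat using (_<_; z≤n)
open import Data.Nat.Divisibility using (∣1⇒≡1)
open import Data.Nat.Induction using (<-wellFounded)
import Data.Nat.Properties as ℕ
open import Data.Nat.Tactic.RingSolver using () renaming (solve-∀ to solveℕ-∀)
open import Data.Product using (Σ; ∃-syntax; _,_; proj₁; proj₂)
open import Data.Sum using (_⊎_; inj₁; inj₂)
open import Function.Base using (_∘_; case_of_)
open import Function.Bundles using (mk⇔)
import Function.Properties.Equivalence as ⇔
open import Induction.WellFounded using (Acc; acc)
open import Relation.Binary.PropositionalEquality
open import Relation.Nullary using (¬_; Dec; yes; no)
open import Relation.Nullary.Decidable using (_×-dec_)
open import Relation.Binary.Definitions using (tri<; tri≈; tri>)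

private variable
  T T' : Triangle
  u u₁ u₂ : Dual
  a b c c' c₁ c₂ d w₁ w₂ : ℕ
  x y : ℤ

Unit : ℤ → Set
Unit x = x ≡ 1ℤ ⊎ x ≡ -1ℤ

Unit-* : Unit x → Unit y → Unit (x * y)
Unit-* (inj₁ refl) (inj₁ refl) = inj₁ refl
Unit-* (inj₁ refl) (inj₂ refl) = inj₂ refl
Unit-* (inj₂ refl) (inj₁ refl) = inj₂ refl
Unit-* (inj₂ refl) (inj₂ refl) = inj₁ refl

Unit-neg : Unit x → Unit (- x)
Unit-neg (inj₁ refl) = inj₂ refl
Unit-neg (inj₂ refl) = inj₁ refl

Unit-square : Unit x → x * x ≡ 1ℤ
Unit-square (inj₁ refl) = refl
Unit-square (inj₂ refl) = refl

Unit⇒≢0 : Unit x → x ≢ 0ℤ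
Unit⇒≢0 (inj₁ refl) ()
Unit⇒≢0 (inj₂ refl) ()

∣∣≡1⇒Unit : ∣ x ∣ ≡ 1 → Unit x
∣∣≡1⇒Unit {+ .1} refl = inj₁ refl
∣∣≡1⇒Unit { -[1+ .0 ]} refl = inj₂ refl

∣i-j∣≤ : ∀ x y → x - y ≤ℤ + c → y - x ≤ℤ + c → ∣ x - y ∣ ≤ c
∣i-j∣≤ {c} x y x-y≤c y-x≤c with ℤ.≤-total x y
... | inj₁ x≤y = ℤ.drop‿+≤+ (subst (_≤ℤ + c) (sym (ℤ.∣-∣-≤ x≤y)) y-x≤c)
... | inj₂ y≤x = ℤ.drop‿+≤+
  (subst (_≤ℤ + c) (trans (sym (ℤ.∣-∣-≤ y≤x)) (cong +_ (ℤ.∣i-j∣≡∣j-i∣ y x))) x-y≤c)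

≤∣∣ : ∀ x → x ≤ℤ + ∣ x ∣
≤∣∣ (+ n) = ℤ.≤-refl
≤∣∣ -[1+ n ] = -≤+

rows : Dual → Dual → Mat2
rows (a , b) (c , d) = mat a b c d

det₂ : Dual → Dual → ℤ
det₂ u v = det (rows u v)

Unimodular : Dual → Dual → Set
Unimodular u v = InGL2Z (rows u v)

e₁ e₂ : Dual
e₁ = (1ℤ , 0ℤ)
e₂ = (0ℤ , 1ℤ)

det₂-swap : ∀ u v → det₂ v u ≡ - det₂ u v
det₂-swap (a , b) (c , d) = identity a b c d
  where
  identity : ∀ a b c d → c * b - d * a ≡ - (a * d - b * c)
  identity = solve-∀

∣det₂-swap∣ : ∀ u v → ∣ det₂ v u ∣ ≡ ∣ det₂ u v ∣
∣det₂-swap∣ u v = trans (cong ∣_∣ (det₂-swap u v)) (ℤ.∣-i∣≡∣i∣ (det₂ u v))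

plücker : ∀ u v x y → det₂ u v * det₂ x y ≡ det₂ u y * det₂ x v - det₂ u x * det₂ y v
plücker (a , b) (c , d) (p , q) (r , s) = identity a b c d p q r s
  where
  identity : ∀ a b c d p q r s →
    (a * d - b * c) * (p * s - q * r) ≡ (a * s - b * r) * (p * d - q * c) - (a * q - b * p) * (r * d - s * c)
  identity = solve-∀

Unimodular-swap : ∀ u v → Unimodular u v → Unimodular v u
Unimodular-swap u v um = subst Unit (sym (det₂-swap u v)) (Unit-neg um)

Unimodular⇒LinIndep : ∀ u v → Unimodular u v → LinIndep u v
Unimodular⇒LinIndep u v = Unit⇒≢0

LinIndep-swap : ∀ u v → LinIndep u v → LinIndep v u
LinIndep-swap u v li det≡0 =
  li (ℤ.∣i∣≡0⇒i≡0 (trans (sym (∣det₂-swap∣ u v)) (cong ∣_∣ det≡0)))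

LinIndep-one-of : ∀ u v x y → Unimodular u v → Unimodular x y → LinIndep u x ⊎ LinIndep u y
LinIndep-one-of u v x y uv xy with det₂ u x ℤ.≟ 0ℤ | det₂ u y ℤ.≟ 0ℤ
... | no ux≢0 | _ = inj₁ ux≢0
... | yes _ | no uy≢0 = inj₂ uy≢0
... | yes ux≡0 | yes uy≡0 = ⊥-elim (Unit⇒≢0 (Unit-* uv xy) (begin
  det₂ u v * det₂ x y                           ≡⟨ plücker u v x y ⟩
  det₂ u y * det₂ x v - det₂ u x * det₂ y v     ≡⟨ cong₂ (λ p q → p * det₂ x v - q * det₂ y v) uy≡0 ux≡0 ⟩
  0ℤ                                            ∎))
  where open ≡-Reasoning

record WidthAtMost (T : Triangle) (u : Dual) (c : ℕ) : Set where
  constructor widthAtMost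
  field
    diff≤ : ∀ i j → u · T i - u · T j ≤ℤ + c

WidthAtMost-mono : c ≤ c' → WidthAtMost T u c → WidthAtMost T u c'
WidthAtMost-mono c≤c' (widthAtMost d) = widthAtMost λ i j → ℤ.≤-trans (d i j) (+≤+ c≤c')

∣diff∣≤ : WidthAtMost T u c → ∀ i j → ∣ u · T i - u · T j ∣ ≤ c
∣diff∣≤ {T} {u} (widthAtMost d) i j = ∣i-j∣≤ (u · T i) (u · T j) (d i j) (d j i)

WidthAtMost-of-∣diff∣≤ : (∀ i j → ∣ u · T i - u · T j ∣ ≤ c) → WidthAtMost T u c
WidthAtMost-of-∣diff∣≤ {u} {T} bound = widthAtMost λ i j → ℤ.≤-trans (≤∣∣ (u · T i - u · T j)) (+≤+ (bound i j))

attained : (_∙_ : Op₂ ℤ) → Selective _≡_ _∙_ → (f : Fin 3 → ℤ) →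
  ∃[ k ] f zero ∙ (f (suc zero) ∙ f (suc (suc zero))) ≡ f k
attained _∙_ sel f
  with sel (f (suc zero)) (f (suc (suc zero))) | sel (f zero) (f (suc zero) ∙ f (suc (suc zero)))
... | _ | inj₁ e = zero , e
... | inj₁ e′ | inj₂ e = suc zero , trans e e′
... | inj₂ e′ | inj₂ e = suc (suc zero) , trans e e′

minV≤ : ∀ u T i → minV u T ≤ℤ u · T i
minV≤ u T zero = ℤ.i⊓j≤i _ _
minV≤ u T (suc zero) = ℤ.≤-trans (ℤ.i⊓j≤j _ _) (ℤ.i⊓j≤i _ _)
minV≤ u T (suc (suc zero)) = ℤ.≤-trans (ℤ.i⊓j≤j _ _) (ℤ.i⊓j≤j _ _)

≤maxV : ∀ u T i → u · T i ≤ℤ maxV u T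
≤maxV u T zero = ℤ.i≤i⊔j _ _
≤maxV u T (suc zero) = ℤ.≤-trans (ℤ.i≤i⊔j _ _) (ℤ.i≤j⊔i _ _)
≤maxV u T (suc (suc zero)) = ℤ.≤-trans (ℤ.i≤j⊔i _ _) (ℤ.i≤j⊔i _ _)

widthℕ : Dual → Triangle → ℕ
widthℕ u T = ∣ width u T ∣

+widthℕ≡width : ∀ u T → + widthℕ u T ≡ width u T
+widthℕ≡width u T = ℤ.0≤i⇒+∣i∣≡i (ℤ.i≤j⇒0≤j-i (ℤ.≤-trans (minV≤ u T zero) (≤maxV u T zero)))

WidthAtMost-width : ∀ u T → WidthAtMost T u (widthℕ u T)
WidthAtMost-width u T = widthAtMost λ i j → subst (u · T i - u · T j ≤ℤ_) (sym (+widthℕ≡width u T))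
  (ℤ.+-mono-≤ (≤maxV u T i) (ℤ.neg-mono-≤ (minV≤ u T j)))

widthℕ≤ : WidthAtMost T u c → widthℕ u T ≤ c
widthℕ≤ {T} {u} {c} (widthAtMost d)
  with attained _⊔_ ℤ.⊔-sel (λ i → u · T i) | attained _⊓_ ℤ.⊓-sel (λ i → u · T i)
... | i , maxᵢ | j , minⱼ =
  ℤ.drop‿+≤+ (subst (_≤ℤ + c) (sym (trans (+widthℕ≡width u T) (cong₂ _-_ maxᵢ minⱼ))) (d i j))

WidthAtMost-of-width≡ : ∀ u T → width u T ≡ + c → WidthAtMost T u c
WidthAtMost-of-width≡ u T w≡c = subst (WidthAtMost T u) (cong ∣_∣ w≡c) (WidthAtMost-width u T)

_⊙_ : Dual → Mat2 → Dual
(u₁ , u₂) ⊙ mat a b c d = (u₁ * a + u₂ * c , u₁ * b + u₂ * d)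

-- det A times the adjugate of A: the inverse of A when det A = ±1
inverse : Mat2 → Mat2
inverse A@(mat a b c d) = mat (det A * d) (det A * - b) (det A * - c) (det A * a)

·-apply-diff : ∀ u A t p q → u · apply A t p - u · apply A t q ≡ (u ⊙ A) · p - (u ⊙ A) · q
·-apply-diff (u₁ , u₂) (mat a b c d) (t₁ , t₂) (x , y) (x' , y') = identity u₁ u₂ a b c d t₁ t₂ x y x' y'
  where
  identity : ∀ u₁ u₂ a b c d t₁ t₂ x y x' y' →
    (u₁ * (a * x + b * y + t₁) + u₂ * (c * x + d * y + t₂)) - (u₁ * (a * x' + b * y' + t₁) + u₂ * (c * x' + d * y' + t₂))
    ≡ ((u₁ * a + u₂ * c) * x + (u₁ * b + u₂ * d) * y) - ((u₁ * a + u₂ * c) * x' + (u₁ * b + u₂ * d) * y')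
  identity = solve-∀

det₂-⊙ : ∀ u v A → det₂ (u ⊙ A) (v ⊙ A) ≡ det₂ u v * det A
det₂-⊙ (u₁ , u₂) (v₁ , v₂) (mat a b c d) = identity u₁ u₂ v₁ v₂ a b c d
  where
  identity : ∀ u₁ u₂ v₁ v₂ a b c d →
    (u₁ * a + u₂ * c) * (v₁ * b + v₂ * d) - (u₁ * b + u₂ * d) * (v₁ * a + v₂ * c) ≡ (u₁ * v₂ - u₂ * v₁) * (a * d - b * c)
  identity = solve-∀

Unimodular-⊙ : ∀ u v A → InGL2Z A → Unimodular u v → Unimodular (u ⊙ A) (v ⊙ A)
Unimodular-⊙ u v A A-unit uv = subst Unit (sym (det₂-⊙ u v A)) (Unit-* uv A-unit)

⊙-inverse : ∀ u A → InGL2Z A → (u ⊙ inverse A) ⊙ A ≡ u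
⊙-inverse (u₁ , u₂) A@(mat a b c d) A-unit = cong₂ _,_
  (trans (first u₁ u₂ (det A) a b c d) (trans (cong (u₁ *_) (Unit-square A-unit)) (ℤ.*-identityʳ u₁)))
  (trans (second u₁ u₂ (det A) a b c d) (trans (cong (u₂ *_) (Unit-square A-unit)) (ℤ.*-identityʳ u₂)))
  where
  first : ∀ u₁ u₂ δ a b c d →
    (u₁ * (δ * d) + u₂ * (δ * - c)) * a + (u₁ * (δ * - b) + u₂ * (δ * a)) * c ≡ u₁ * (δ * (a * d - b * c))
  first = solve-∀
  second : ∀ u₁ u₂ δ a b c d →
    (u₁ * (δ * d) + u₂ * (δ * - c)) * b + (u₁ * (δ * - b) + u₂ * (δ * a)) * d ≡ u₂ * (δ * (a * d - b * c))
  second = solve-∀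

InGL2Z-inverse : ∀ A → InGL2Z A → InGL2Z (inverse A)
InGL2Z-inverse A@(mat a b c d) A-unit =
  subst Unit (sym (begin
    det (inverse A)  ≡⟨ identity (det A) a b c d ⟩
    (det A * det A) * det A  ≡⟨ cong (_* det A) (Unit-square A-unit) ⟩
    1ℤ * det A  ≡⟨ ℤ.*-identityˡ _ ⟩
    det A  ∎)) A-unit
  where
  open ≡-Reasoning
  identity : ∀ δ a b c d → (δ * d) * (δ * a) - (δ * - b) * (δ * - c) ≡ (δ * δ) * (a * d - b * c)
  identity = solve-∀

WidthAtMost-pullback : ∀ {A : Mat2} {t : Point} {π : Fin 3 → Fin 3} →
  (∀ i → apply A t (T i) ≡ T' (π i)) → WidthAtMost T' u c → WidthAtMost T (u ⊙ A) c
WidthAtMost-pullback {T} {T'} {u} {c} {A} {t} {π} T↦T' (widthAtMost d) = widthAtMost λ i j →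
  subst (_≤ℤ + c)
    (trans (cong₂ (λ p q → u · p - u · q) (sym (T↦T' i)) (sym (T↦T' j))) (·-apply-diff u A t (T i) (T j)))
    (d (π i) (π j))

WidthAtMost-pushforward : ∀ {A : Mat2} {t : Point} {π : Fin 3 → Fin 3} →
  (∀ i → T' i ≡ apply A t (T (π i))) → WidthAtMost T (u ⊙ A) c → WidthAtMost T' u c
WidthAtMost-pushforward {T'} {T} {u} {c} {A} {t} {π} T'≡AT (widthAtMost d) = widthAtMost λ i j →
  subst (_≤ℤ + c) (sym (trans (cong₂ (λ p q → u · p - u · q) (T'≡AT i) (T'≡AT j)) (·-apply-diff u A t _ _)))
    (d (π i) (π j))

-- Fitting into a box after a unimodular change of coordinates

FitsBox : Triangle → ℕ → ℕ → Set
FitsBox T c₁ c₂ = Σ Dual λ u₁ → Σ Dual λ u₂ → Unimodular u₁ u₂ × WidthAtMost T u₁ c₁ × WidthAtMost T u₂ c₂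

FitsBox-swap : FitsBox T c₂ c₁ → FitsBox T c₁ c₂
FitsBox-swap (u₁ , u₂ , um , b₁ , b₂) = u₂ , u₁ , Unimodular-swap u₁ u₂ um , b₂ , b₁

FitsBox-monoʳ : c₂ ≤ c → FitsBox T c₁ c₂ → FitsBox T c₁ c
FitsBox-monoʳ c₂≤c (u₁ , u₂ , um , b₁ , b₂) = u₁ , u₂ , um , b₁ , WidthAtMost-mono c₂≤c b₂

FitsBox-pullback : AffEquiv T T' → FitsBox T' c₁ c₂ → FitsBox T c₁ c₂
FitsBox-pullback (A , A-unit , t , σ , T↦T') (u₁ , u₂ , um , b₁ , b₂) =
  u₁ ⊙ A , u₂ ⊙ A , Unimodular-⊙ u₁ u₂ A A-unit um , pull b₁ , pull b₂
  where
  pull : ∀ {u c} → WidthAtMost _ u c → WidthAtMost _ (u ⊙ A) c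
  pull = WidthAtMost-pullback {π = λ i → σ ⟨$⟩ʳ i} T↦T'

FitsBox-pushforward : AffEquiv T T' → FitsBox T c₁ c₂ → FitsBox T' c₁ c₂
FitsBox-pushforward {T} {T'} (A , A-unit , t , σ , T↦T') (u₁ , u₂ , um , b₁ , b₂) =
  u₁ ⊙ A⁻¹ , u₂ ⊙ A⁻¹ , Unimodular-⊙ u₁ u₂ A⁻¹ (InGL2Z-inverse A A-unit) um , push u₁ b₁ , push u₂ b₂
  where
  A⁻¹ = inverse A
  T'≡AT : ∀ i → T' i ≡ apply A t (T (σ ⟨$⟩ˡ i))
  T'≡AT i = trans (cong T' (sym (inverseʳ σ))) (sym (T↦T' (σ ⟨$⟩ˡ i)))
  push : ∀ {c} u → WidthAtMost T u c → WidthAtMost T' (u ⊙ A⁻¹) c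
  push u b = WidthAtMost-pushforward {π = λ i → σ ⟨$⟩ˡ i} T'≡AT
    (subst (λ w → WidthAtMost T w _) (sym (⊙-inverse u A A-unit)) b)

coordinate-diff≤ : ∀ {x x'} → x ≤ℤ + c → 0ℤ ≤ℤ x' → x - x' ≤ℤ + c
coordinate-diff≤ {c} {x} {x'} x≤c 0≤x' =
  subst (x - x' ≤ℤ_) (ℤ.+-identityʳ (+ c)) (ℤ.+-mono-≤ x≤c (ℤ.neg-mono-≤ 0≤x'))

InBox⇒FitsBox : InBox T c₁ c₂ → FitsBox T c₁ c₂
InBox⇒FitsBox {T} box = e₁ , e₂ , inj₁ refl ,
  widthAtMost (λ i j → subst (_≤ℤ _) (sym (e₁-diff (T i) (T j)))
    (coordinate-diff≤ (proj₂ (proj₁ (box i))) (proj₁ (proj₁ (box j))))) ,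
  widthAtMost (λ i j → subst (_≤ℤ _) (sym (e₂-diff (T i) (T j)))
    (coordinate-diff≤ (proj₂ (proj₂ (box i))) (proj₁ (proj₂ (box j)))))
  where
  e₁-diff : ∀ p q → e₁ · p - e₁ · q ≡ proj₁ p - proj₁ q
  e₁-diff (x , y) (x' , y') = identity x y x' y'
    where
    identity : ∀ x y x' y' → (1ℤ * x + 0ℤ * y) - (1ℤ * x' + 0ℤ * y') ≡ x - x'
    identity = solve-∀
  e₂-diff : ∀ p q → e₂ · p - e₂ · q ≡ proj₂ p - proj₂ q
  e₂-diff (x , y) (x' , y') = identity x y x' y'
    where
    identity : ∀ x y x' y' → (0ℤ * x + 1ℤ * y) - (0ℤ * x' + 1ℤ * y') ≡ y - y'
    identity = solve-∀

-- The coordinates (u₁ · p - minV u₁ T , u₂ · p - minV u₂ T) put T into the box.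
FitsBox⇒EquivToSubBox : FitsBox T c₁ c₂ → EquivToSubBox T c₁ c₂
FitsBox⇒EquivToSubBox {T} {c₁} {c₂} (u₁ , u₂ , um , b₁ , b₂) =
  (λ i → apply A t (T i)) , (A , um , t , Permutation.id , λ i → refl) , λ i → coordinate b₁ i , coordinate b₂ i
  where
  A = rows u₁ u₂
  t = (- minV u₁ T , - minV u₂ T)
  coordinate : ∀ {u c} → WidthAtMost T u c → ∀ i → (0ℤ ≤ℤ u · T i - minV u T) × (u · T i - minV u T ≤ℤ + c)
  coordinate {u} {c} (widthAtMost d) i with attained _⊓_ ℤ.⊓-sel (λ i → u · T i)
  ... | k , minₖ = ℤ.i≤j⇒0≤j-i (minV≤ u T i) , subst (λ m → u · T i - m ≤ℤ + c) (sym minₖ) (d i k)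

EquivToSubBox⇒FitsBox : EquivToSubBox T c₁ c₂ → FitsBox T c₁ c₂
EquivToSubBox⇒FitsBox (T' , e , box) = FitsBox-pullback e (InBox⇒FitsBox box)

-- Reduction of an independent pair of directions to a unimodular one

≤-of-half-weights : ∀ {n x A B c c'} .{{_ : ℕ.NonZero n}} →
  n ℕ.* x ≤ A ℕ.* c ℕ.+ B ℕ.* c' → 2 ℕ.* A ≤ n → 2 ℕ.* B ≤ n → c' ≤ c → x ≤ c
≤-of-half-weights {n} {x} {A} {B} {c} {c'} hyp 2A≤n 2B≤n c'≤c =
  ℕ.*-cancelˡ-≤ n (ℕ.*-cancelˡ-≤ 2 (begin
    2 ℕ.* (n ℕ.* x)                       ≤⟨ ℕ.*-monoʳ-≤ 2 hyp ⟩
    2 ℕ.* (A ℕ.* c ℕ.+ B ℕ.* c')          ≡⟨ distribute A B c c' ⟩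
    (2 ℕ.* A) ℕ.* c ℕ.+ (2 ℕ.* B) ℕ.* c'  ≤⟨ ℕ.+-mono-≤ (ℕ.*-monoˡ-≤ c 2A≤n) (ℕ.*-mono-≤ 2B≤n c'≤c) ⟩
    n ℕ.* c ℕ.+ n ℕ.* c                   ≡⟨ double (n ℕ.* c) ⟨
    2 ℕ.* (n ℕ.* c)                       ∎))
  where
  open ℕ.≤-Reasoning
  distribute : ∀ A B c c' → 2 ℕ.* (A ℕ.* c ℕ.+ B ℕ.* c') ≡ (2 ℕ.* A) ℕ.* c ℕ.+ (2 ℕ.* B) ℕ.* c'
  distribute = solveℕ-∀
  double : ∀ m → 2 ℕ.* m ≡ m ℕ.+ m
  double = solveℕ-∀

∣∣<-of-half : x ≢ 0ℤ → 2 ℕ.* ∣ x ∣ ≤ c → ∣ x ∣ < c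
∣∣<-of-half {x} x≢0 2x≤c with ∣ x ∣ in eq
... | 0 = ⊥-elim (x≢0 (ℤ.∣i∣≡0⇒i≡0 eq))
... | ℕ.suc m = ℕ.<-≤-trans (ℕ.m<m+n (ℕ.suc m) (ℕ.s≤s z≤n)) 2x≤c

2*[n∸r]≤n : ∀ {n r} → r ≤ n → n ≤ 2 ℕ.* r → 2 ℕ.* (n ℕ.∸ r) ≤ n
2*[n∸r]≤n {n} {r} r≤n n≤2r = begin
  2 ℕ.* (n ℕ.∸ r)          ≡⟨ double (n ℕ.∸ r) ⟩
  n ℕ.∸ r ℕ.+ (n ℕ.∸ r)    ≤⟨ ℕ.+-monoʳ-≤ (n ℕ.∸ r) n∸r≤r ⟩
  n ℕ.∸ r ℕ.+ r            ≡⟨ ℕ.m∸n+n≡m r≤n ⟩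
  n                        ∎
  where
  open ℕ.≤-Reasoning
  double : ∀ m → 2 ℕ.* m ≡ m ℕ.+ m
  double = solveℕ-∀
  n∸r≤r : n ℕ.∸ r ≤ r
  n∸r≤r = ℕ.≤-trans (ℕ.∸-monoˡ-≤ r (ℕ.≤-trans n≤2r (ℕ.≤-reflexive (double r)))) (ℕ.≤-reflexive (ℕ.m+n∸n≡m r r))

nearest-multiple-of-remainder : ∀ r q n → r ≤ n → ∃[ k ] 2 ℕ.* ∣ (+ r + q * + n) - k * + n ∣ ≤ n
nearest-multiple-of-remainder r q n r≤n with 2 ℕ.* r ℕ.≤? n
... | yes 2r≤n = q , subst (λ m → 2 ℕ.* ∣ m ∣ ≤ n) (sym (round-down (+ r) q (+ n))) 2r≤n
  where
  round-down : ∀ r q n → (r + q * n) - q * n ≡ r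
  round-down = solve-∀
... | no 2r≰n = q + 1ℤ , subst (λ m → 2 ℕ.* m ≤ n) (sym ∣round-up∣) (2*[n∸r]≤n r≤n (ℕ.<⇒≤ (ℕ.≰⇒> 2r≰n)))
  where
  round-up : ∀ r q n → (r + q * n) - (q + 1ℤ) * n ≡ r - n
  round-up = solve-∀
  ∣round-up∣ : ∣ (+ r + q * + n) - (q + 1ℤ) * + n ∣ ≡ n ℕ.∸ r
  ∣round-up∣ = trans (cong ∣_∣ (trans (round-up (+ r) q (+ n)) (ℤ.[+m]-[+n]≡m⊖n r n))) (ℤ.∣⊖∣-≤ r≤n)

nearest-multiple⁺ : ∀ a n .{{_ : ℕ.NonZero n}} → ∃[ k ] 2 ℕ.* ∣ a - k * + n ∣ ≤ n
nearest-multiple⁺ a n = subst (λ a → ∃[ k ] 2 ℕ.* ∣ a - k * + n ∣ ≤ n) (sym (a≡a%ℕn+[a/ℕn]*n a n))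
  (nearest-multiple-of-remainder (a %ℕ n) (a /ℕ n) n (ℕ.<⇒≤ (n%ℕd<d a n)))

nearest-multiple : ∀ a D → D ≢ 0ℤ → ∃[ k ] 2 ℕ.* ∣ a - k * D ∣ ≤ ∣ D ∣
nearest-multiple a (+ 0) D≢0 = ⊥-elim (D≢0 refl)
nearest-multiple a (+ ℕ.suc n) _ = nearest-multiple⁺ a (ℕ.suc n)
nearest-multiple a -[1+ n ] _ with nearest-multiple⁺ a (ℕ.suc n)
... | k , bound = - k , subst (λ m → 2 ℕ.* ∣ m ∣ ≤ ℕ.suc n) (sym (negate a k (+ ℕ.suc n))) bound
  where
  negate : ∀ a k n → a - (- k) * (- n) ≡ a - k * n
  negate = solve-∀

cramer : ∀ u₁ u₂ z p q →
  det₂ u₁ u₂ * (z · p - z · q) ≡ det₂ z u₂ * (u₁ · p - u₁ · q) + det₂ u₁ z * (u₂ · p - u₂ · q)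
cramer (a , b) (c , d) (r , s) (x , y) (x' , y') = identity a b c d r s x y x' y'
  where
  identity : ∀ a b c d r s x y x' y' →
    (a * d - b * c) * ((r * x + s * y) - (r * x' + s * y'))
    ≡ (r * d - s * c) * ((a * x + b * y) - (a * x' + b * y')) + (a * s - b * r) * ((c * x + d * y) - (c * x' + d * y'))
  identity = solve-∀

weighted-bound : WidthAtMost T u₁ c₁ → WidthAtMost T u₂ c₂ → ∀ z i j →
  ∣ det₂ u₁ u₂ ∣ ℕ.* ∣ z · T i - z · T j ∣ ≤ ∣ det₂ z u₂ ∣ ℕ.* c₁ ℕ.+ ∣ det₂ u₁ z ∣ ℕ.* c₂
weighted-bound {T} {u₁} {c₁} {u₂} {c₂} b₁ b₂ z i j = begin
  ∣ det₂ u₁ u₂ ∣ ℕ.* ∣ z · T i - z · T j ∣              ≡⟨ ℤ.abs-* (det₂ u₁ u₂) _ ⟨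
  ∣ det₂ u₁ u₂ * (z · T i - z · T j) ∣                 ≡⟨ cong ∣_∣ (cramer u₁ u₂ z (T i) (T j)) ⟩
  ∣ α * (u₁ · T i - u₁ · T j) + β * (u₂ · T i - u₂ · T j) ∣
    ≤⟨ ℤ.∣i+j∣≤∣i∣+∣j∣ (α * _) (β * _) ⟩
  ∣ α * (u₁ · T i - u₁ · T j) ∣ ℕ.+ ∣ β * (u₂ · T i - u₂ · T j) ∣
    ≡⟨ cong₂ ℕ._+_ (ℤ.abs-* α _) (ℤ.abs-* β _) ⟩
  ∣ α ∣ ℕ.* ∣ u₁ · T i - u₁ · T j ∣ ℕ.+ ∣ β ∣ ℕ.* ∣ u₂ · T i - u₂ · T j ∣
    ≤⟨ ℕ.+-mono-≤ (ℕ.*-monoʳ-≤ ∣ α ∣ (∣diff∣≤ b₁ i j)) (ℕ.*-monoʳ-≤ ∣ β ∣ (∣diff∣≤ b₂ i j)) ⟩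
  ∣ α ∣ ℕ.* c₁ ℕ.+ ∣ β ∣ ℕ.* c₂                           ∎
  where
  open ℕ.≤-Reasoning
  α = det₂ z u₂
  β = det₂ u₁ z

infixl 6 _-ᵈ_
infixl 7 _∙ᵈ_

_-ᵈ_ : Dual → Dual → Dual
(a , b) -ᵈ (c , d) = (a - c , b - d)

_∙ᵈ_ : ℤ → Dual → Dual
k ∙ᵈ (a , b) = (k * a , k * b)

det₂-shiftˡ : ∀ z k₁ k₂ u₁ u₂ → det₂ (z -ᵈ k₁ ∙ᵈ u₁ -ᵈ k₂ ∙ᵈ u₂) u₂ ≡ det₂ z u₂ - k₁ * det₂ u₁ u₂
det₂-shiftˡ (p , q) k₁ k₂ (a , b) (c , d) = identity p q k₁ k₂ a b c d
  where
  identity : ∀ p q k₁ k₂ a b c d →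
    (p - k₁ * a - k₂ * c) * d - (q - k₁ * b - k₂ * d) * c ≡ (p * d - q * c) - k₁ * (a * d - b * c)
  identity = solve-∀

det₂-shiftʳ : ∀ z k₁ k₂ u₁ u₂ → det₂ u₁ (z -ᵈ k₁ ∙ᵈ u₁ -ᵈ k₂ ∙ᵈ u₂) ≡ det₂ u₁ z - k₂ * det₂ u₁ u₂
det₂-shiftʳ (p , q) k₁ k₂ (a , b) (c , d) = identity p q k₁ k₂ a b c d
  where
  identity : ∀ p q k₁ k₂ a b c d →
    a * (q - k₁ * b - k₂ * d) - b * (p - k₁ * a - k₂ * c) ≡ (a * q - b * p) - k₂ * (a * d - b * c)
  identity = solve-∀

-- If det₂ u₁ u₂ divided the coordinates of e₁ and e₂ with respect to u₁ , u₂, then by the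
-- Plücker relation its square would divide det₂ u₁ u₂ * det₂ e₁ e₂ = det₂ u₁ u₂.
outside-sublattice : det₂ u₁ u₂ ≢ 0ℤ → ∣ det₂ u₁ u₂ ∣ ≢ 1 →
  ∃[ z ] ¬ ((det₂ u₁ u₂ ∣ det₂ z u₂) × (det₂ u₁ u₂ ∣ det₂ u₁ z))
outside-sublattice {u₁} {u₂} D≢0 ∣D∣≢1
  with (det₂ u₁ u₂ ∣? det₂ e₁ u₂) ×-dec (det₂ u₁ u₂ ∣? det₂ u₁ e₁)
     | (det₂ u₁ u₂ ∣? det₂ e₂ u₂) ×-dec (det₂ u₁ u₂ ∣? det₂ u₁ e₂)
... | no e₁∉ | _ = e₁ , e₁∉
... | yes _ | no e₂∉ = e₂ , e₂∉
... | yes (D∣α₁ , D∣β₁) | yes (D∣α₂ , D∣β₂) =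
  ⊥-elim (∣D∣≢1 (∣1⇒≡1 (∣⇒∣ᵤ (*-cancelˡ-∣ D {{≢-nonZero D≢0}} D²∣D))))
  where
  D = det₂ u₁ u₂
  product : ∀ {x y} → D ∣ x → D ∣ y → D * D ∣ x * y
  product {x} {y} D∣x D∣y = ∣-trans (*-monoʳ-∣ D D∣y) (*-monoˡ-∣ y D∣x)
  D²∣D : D * D ∣ D * 1ℤ
  D²∣D = subst (D * D ∣_) (sym (plücker u₁ u₂ e₁ e₂)) (∣m∣n⇒∣m-n (product D∣β₂ D∣α₁) (product D∣β₁ D∣α₂))

short-vector : det₂ u₁ u₂ ≢ 0ℤ → ∣ det₂ u₁ u₂ ∣ ≢ 1 → ∃[ z ]
  2 ℕ.* ∣ det₂ z u₂ ∣ ≤ ∣ det₂ u₁ u₂ ∣ × 2 ℕ.* ∣ det₂ u₁ z ∣ ≤ ∣ det₂ u₁ u₂ ∣ ×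
  ¬ (det₂ z u₂ ≡ 0ℤ × det₂ u₁ z ≡ 0ℤ)
short-vector {u₁} {u₂} D≢0 ∣D∣≢1 with outside-sublattice {u₁} {u₂} D≢0 ∣D∣≢1
... | z , z∉ with nearest-multiple (det₂ z u₂) (det₂ u₁ u₂) D≢0 | nearest-multiple (det₂ u₁ z) (det₂ u₁ u₂) D≢0
...   | k₁ , bound₁ | k₂ , bound₂ =
  z' , subst (λ m → 2 ℕ.* ∣ m ∣ ≤ _) (sym α'≡) bound₁ , subst (λ m → 2 ℕ.* ∣ m ∣ ≤ _) (sym β'≡) bound₂ ,
  λ (α'≡0 , β'≡0) → z∉ ( divides k₁ (ℤ.i-j≡0⇒i≡j _ _ (trans (sym α'≡) α'≡0))
                       , divides k₂ (ℤ.i-j≡0⇒i≡j _ _ (trans (sym β'≡) β'≡0)))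
  where
  z' = z -ᵈ k₁ ∙ᵈ u₁ -ᵈ k₂ ∙ᵈ u₂
  α'≡ = det₂-shiftˡ z k₁ k₂ u₁ u₂
  β'≡ = det₂-shiftʳ z k₁ k₂ u₁ u₂

SmallerPair : Triangle → Dual → Dual → ℕ → ℕ → Set
SmallerPair T u₁ u₂ c₁ c₂ = Σ Dual λ v₁ → Σ Dual λ v₂ →
  ∣ det₂ v₁ v₂ ∣ < ∣ det₂ u₁ u₂ ∣ × LinIndep v₁ v₂ × WidthAtMost T v₁ c₁ × WidthAtMost T v₂ c₂

-- The weights of weighted-bound are at most half of ∣ det₂ u₁ u₂ ∣, so with c₂ ≤ c₁ the
-- vector z inherits the larger bound c₁, or c₂ when det₂ z u₂ ≡ 0ℤ.
exchange : det₂ u₁ u₂ ≢ 0ℤ → c₂ ≤ c₁ → WidthAtMost T u₁ c₁ → WidthAtMost T u₂ c₂ → ∀ z →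
  2 ℕ.* ∣ det₂ z u₂ ∣ ≤ ∣ det₂ u₁ u₂ ∣ → 2 ℕ.* ∣ det₂ u₁ z ∣ ≤ ∣ det₂ u₁ u₂ ∣ →
  ¬ (det₂ z u₂ ≡ 0ℤ × det₂ u₁ z ≡ 0ℤ) → Dec (det₂ z u₂ ≡ 0ℤ) → SmallerPair T u₁ u₂ c₁ c₂
exchange {u₁} {u₂} {c₂} {c₁} {T} D≢0 c₂≤c₁ b₁ b₂ z 2α≤D 2β≤D ¬α≡0×β≡0 (no α≢0) =
  z , u₂ , ∣∣<-of-half α≢0 2α≤D , α≢0 ,
  WidthAtMost-of-∣diff∣≤ (λ i j →
    ≤-of-half-weights {A = ∣ det₂ z u₂ ∣} {B = ∣ det₂ u₁ z ∣} {{≢-nonZero D≢0}}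
      (weighted-bound b₁ b₂ z i j) 2α≤D 2β≤D c₂≤c₁) , b₂
exchange {u₁} {u₂} {c₂} {c₁} {T} D≢0 c₂≤c₁ b₁ b₂ z 2α≤D 2β≤D ¬α≡0×β≡0 (yes α≡0) =
  u₁ , z , ∣∣<-of-half β≢0 2β≤D , β≢0 , b₁ ,
  WidthAtMost-of-∣diff∣≤ (λ i j →
    ≤-of-half-weights {A = 0} {B = ∣ det₂ u₁ z ∣} {{≢-nonZero D≢0}} (bound i j) z≤n 2β≤D ℕ.≤-refl)
  where
  β≢0 : det₂ u₁ z ≢ 0ℤ
  β≢0 β≡0 = ¬α≡0×β≡0 (α≡0 , β≡0)
  bound : ∀ i j → ∣ det₂ u₁ u₂ ∣ ℕ.* ∣ z · T i - z · T j ∣ ≤ ∣ det₂ u₁ z ∣ ℕ.* c₂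
  bound i j = subst (λ α → ∣ det₂ u₁ u₂ ∣ ℕ.* ∣ z · T i - z · T j ∣ ≤ ∣ α ∣ ℕ.* c₁ ℕ.+ ∣ det₂ u₁ z ∣ ℕ.* c₂)
    α≡0 (weighted-bound b₁ b₂ z i j)

descent-step : det₂ u₁ u₂ ≢ 0ℤ → ∣ det₂ u₁ u₂ ∣ ≢ 1 → c₂ ≤ c₁ →
  WidthAtMost T u₁ c₁ → WidthAtMost T u₂ c₂ → SmallerPair T u₁ u₂ c₁ c₂
descent-step {u₁} {u₂} D≢0 ∣D∣≢1 c₂≤c₁ b₁ b₂ =
  let z , 2α≤D , 2β≤D , ¬α≡0×β≡0 = short-vector {u₁} {u₂} D≢0 ∣D∣≢1
  in exchange D≢0 c₂≤c₁ b₁ b₂ z 2α≤D 2β≤D ¬α≡0×β≡0 (det₂ z u₂ ℤ.≟ 0ℤ)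

FitsBox-descent-cases : Acc _<_ ∣ det₂ u₁ u₂ ∣ → LinIndep u₁ u₂ → WidthAtMost T u₁ c₁ → WidthAtMost T u₂ c₂ →
  Dec (∣ det₂ u₁ u₂ ∣ ≡ 1) → c₂ ≤ c₁ ⊎ c₁ ≤ c₂ → FitsBox T c₁ c₂

FitsBox-descent : Acc _<_ ∣ det₂ u₁ u₂ ∣ → LinIndep u₁ u₂ → WidthAtMost T u₁ c₁ → WidthAtMost T u₂ c₂ →
  FitsBox T c₁ c₂
FitsBox-descent {u₁} {u₂} {T} {c₁} {c₂} rec li b₁ b₂ =
  FitsBox-descent-cases {u₁} {u₂} rec li b₁ b₂ (∣ det₂ u₁ u₂ ∣ ℕ.≟ 1) (ℕ.≤-total c₂ c₁)

FitsBox-descent-cases {u₁} {u₂} _ _ b₁ b₂ (yes ∣D∣≡1) _ = u₁ , u₂ , ∣∣≡1⇒Unit ∣D∣≡1 , b₁ , b₂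
FitsBox-descent-cases {u₁} {u₂} (acc smaller) li b₁ b₂ (no ∣D∣≢1) (inj₁ c₂≤c₁) =
  let v₁ , v₂ , lt , li' , b₁' , b₂' = descent-step {u₁} {u₂} li ∣D∣≢1 c₂≤c₁ b₁ b₂
  in FitsBox-descent {v₁} {v₂} (smaller lt) li' b₁' b₂'
FitsBox-descent-cases {u₁} {u₂} (acc smaller) li b₁ b₂ (no ∣D∣≢1) (inj₂ c₁≤c₂) =
  let v₁ , v₂ , lt , li' , b₂' , b₁' =
        descent-step {u₂} {u₁} (LinIndep-swap u₁ u₂ li) (∣D∣≢1 ∘ trans (sym (∣det₂-swap∣ u₁ u₂))) c₁≤c₂ b₂ b₁
  in FitsBox-swap (FitsBox-descent {v₁} {v₂} (smaller (subst (∣ det₂ v₁ v₂ ∣ <_) (∣det₂-swap∣ u₁ u₂) lt))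
                    li' b₂' b₁')

FitsBox-of-LinIndep : LinIndep u₁ u₂ → WidthAtMost T u₁ c₁ → WidthAtMost T u₂ c₂ → FitsBox T c₁ c₂
FitsBox-of-LinIndep = FitsBox-descent (<-wellFounded _)

FitsBox-combine : FitsBox T a b → FitsBox T c d → c ≤ d → FitsBox T a d
FitsBox-combine (u , v , uv , bᵤ , _) (x , y , xy , bₓ , b_y) c≤d with LinIndep-one-of u v x y uv xy
... | inj₁ ux = FitsBox-monoʳ c≤d (FitsBox-of-LinIndep ux bᵤ bₓ)
... | inj₂ uy = FitsBox-of-LinIndep uy bᵤ b_y

LexMinimalFit : Triangle → ℕ → ℕ → Set
LexMinimalFit T w₁ w₂ = FitsBox T w₁ w₂ × (∀ a b → (a , b) <lexℕ (w₁ , w₂) → ¬ FitsBox T a b)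

≤×≤⇒<lexℕ⊎≡ : a ≤ w₁ → b ≤ w₂ → (a , b) <lexℕ (w₁ , w₂) ⊎ (a ≡ w₁ × b ≡ w₂)
≤×≤⇒<lexℕ⊎≡ a≤w₁ b≤w₂ with ℕ.m≤n⇒m<n∨m≡n a≤w₁ | ℕ.m≤n⇒m<n∨m≡n b≤w₂
... | inj₁ a<w₁ | _ = inj₁ (inj₁ a<w₁)
... | inj₂ a≡w₁ | inj₁ b<w₂ = inj₁ (inj₂ (a≡w₁ , b<w₂))
... | inj₂ a≡w₁ | inj₂ b≡w₂ = inj₂ (a≡w₁ , b≡w₂)

<lexℕ-≤×≤-trans : c ≤ a → d ≤ b → (a , b) <lexℕ (w₁ , w₂) → (c , d) <lexℕ (w₁ , w₂)
<lexℕ-≤×≤-trans c≤a d≤b (inj₁ a<w₁) = inj₁ (ℕ.≤-<-trans c≤a a<w₁)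
<lexℕ-≤×≤-trans c≤a d≤b (inj₂ (refl , b<w₂)) with ≤×≤⇒<lexℕ⊎≡ c≤a (ℕ.<⇒≤ (ℕ.≤-<-trans d≤b b<w₂))
... | inj₁ lt = lt
... | inj₂ (c≡a , _) = inj₂ (c≡a , ℕ.≤-<-trans d≤b b<w₂)

≤lex⇒≮lexℕ : (+ w₁ , + w₂) ≤lex (+ a , + b) → ¬ (a , b) <lexℕ (w₁ , w₂)
≤lex⇒≮lexℕ (inj₁ (inj₁ (+<+ w₁<a))) (inj₁ a<w₁) = ℕ.<-asym w₁<a a<w₁
≤lex⇒≮lexℕ (inj₁ (inj₁ (+<+ w₁<a))) (inj₂ (refl , _)) = ℕ.<-irrefl refl w₁<a
≤lex⇒≮lexℕ (inj₁ (inj₂ (refl , _))) (inj₁ a<w₁) = ℕ.<-irrefl refl a<w₁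
≤lex⇒≮lexℕ (inj₁ (inj₂ (refl , +<+ w₂<b))) (inj₂ (_ , b<w₂)) = ℕ.<-asym w₂<b b<w₂
≤lex⇒≮lexℕ (inj₂ refl) (inj₁ a<w₁) = ℕ.<-irrefl refl a<w₁
≤lex⇒≮lexℕ (inj₂ refl) (inj₂ (_ , b<w₂)) = ℕ.<-irrefl refl b<w₂

≮lexℕ⇒≤lex : ¬ (a , b) <lexℕ (w₁ , w₂) → (+ w₁ , + w₂) ≤lex (+ a , + b)
≮lexℕ⇒≤lex {a} {b} {w₁} {w₂} ≮ with ℕ.<-cmp w₁ a | ℕ.<-cmp w₂ b
... | tri< w₁<a _ _ | _ = inj₁ (inj₁ (+<+ w₁<a))
... | tri> _ _ a<w₁ | _ = ⊥-elim (≮ (inj₁ a<w₁))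
... | tri≈ _ refl _ | tri< w₂<b _ _ = inj₁ (inj₂ (refl , +<+ w₂<b))
... | tri≈ _ refl _ | tri≈ _ refl _ = inj₂ refl
... | tri≈ _ refl _ | tri> _ _ b<w₂ = ⊥-elim (≮ (inj₂ (refl , b<w₂)))

HasWidths⇔LexMinimalFit : HasWidths T (+ w₁) (+ w₂) ⇔ LexMinimalFit T w₁ w₂
HasWidths⇔LexMinimalFit {T} {w₁} {w₂} = mk⇔ to from
  where
  to : HasWidths T (+ w₁) (+ w₂) → LexMinimalFit T w₁ w₂
  to ((u₁ , u₂ , li , width₁ , width₂) , minimal) =
    FitsBox-of-LinIndep li (WidthAtMost-of-width≡ u₁ T width₁) (WidthAtMost-of-width≡ u₂ T width₂) ,
    λ { a b lt (x , y , xy , bₓ , b_y) → ≤lex⇒≮lexℕ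
          (subst₂ (λ p q → (+ w₁ , + w₂) ≤lex (p , q)) (sym (+widthℕ≡width x T)) (sym (+widthℕ≡width y T))
            (minimal x y (Unimodular⇒LinIndep x y xy)))
          (<lexℕ-≤×≤-trans (widthℕ≤ bₓ) (widthℕ≤ b_y) lt) }
  from : LexMinimalFit T w₁ w₂ → HasWidths T (+ w₁) (+ w₂)
  from ((x , y , xy , bₓ , b_y) , minimal) with ≤×≤⇒<lexℕ⊎≡ (widthℕ≤ bₓ) (widthℕ≤ b_y)
  ... | inj₁ lt = ⊥-elim (minimal _ _ lt (x , y , xy , WidthAtMost-width x T , WidthAtMost-width y T))
  ... | inj₂ (widthₓ , width_y) =
    (x , y , Unimodular⇒LinIndep x y xy ,
      trans (sym (+widthℕ≡width x T)) (cong +_ widthₓ) , trans (sym (+widthℕ≡width y T)) (cong +_ width_y)) ,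
    λ u₁ u₂ li → subst₂ (λ p q → (+ w₁ , + w₂) ≤lex (p , q)) (+widthℕ≡width u₁ T) (+widthℕ≡width u₂ T)
      (≮lexℕ⇒≤lex λ lt → minimal _ _ lt
        (FitsBox-of-LinIndep li (WidthAtMost-width u₁ T) (WidthAtMost-width u₂ T)))

InTlex⇔LexMinimalFit : InTlex w₁ w₂ T ⇔ LexMinimalFit T w₁ w₂
InTlex⇔LexMinimalFit {w₁} {w₂} {T} = mk⇔ to from
  where
  to : InTlex w₁ w₂ T → LexMinimalFit T w₁ w₂
  to (T' , e , box , minimal) = FitsBox-pullback e (InBox⇒FitsBox box) ,
    λ a b lt fits → minimal a b lt (FitsBox⇒EquivToSubBox (FitsBox-pushforward e fits))
  from : LexMinimalFit T w₁ w₂ → InTlex w₁ w₂ T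
  from (fits , minimal) with FitsBox⇒EquivToSubBox fits
  ... | T' , e , box = T' , e , box , λ a b lt E → minimal a b lt (FitsBox-pullback e (EquivToSubBox⇒FitsBox E))

-- A smaller box a × b with a < w₁ (and possibly b > w₂) is excluded by combining it with the
-- box w₁ × w₂ into a × w₂, which is where w₁ ≤ w₂ enters.
InTlex⇔InTsub : w₁ ≤ w₂ → InTlex w₁ w₂ T ⇔ InTsub w₁ w₂ T
InTlex⇔InTsub {w₁} {w₂} {T} w₁≤w₂ = mk⇔ to from
  where
  to : InTlex w₁ w₂ T → InTsub w₁ w₂ T
  to (T' , e , box , minimal) = T' , e , box , λ a b a≤w₁ b≤w₂ E → case ≤×≤⇒<lexℕ⊎≡ a≤w₁ b≤w₂ of λ where
    (inj₁ lt) → ⊥-elim (minimal a b lt E)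
    (inj₂ a,b≡w₁,w₂) → a,b≡w₁,w₂
  from : InTsub w₁ w₂ T → InTlex w₁ w₂ T
  from (T' , e , box , only) = T' , e , box , excluded
    where
    excluded : ∀ a b → (a , b) <lexℕ (w₁ , w₂) → ¬ EquivToSubBox T' a b
    excluded a b (inj₂ (a≡w₁ , b<w₂)) E = ℕ.<-irrefl (proj₂ (only a b (ℕ.≤-reflexive a≡w₁) (ℕ.<⇒≤ b<w₂) E)) b<w₂
    excluded a b (inj₁ a<w₁) E = ℕ.<-irrefl (proj₁ (only a w₂ (ℕ.<⇒≤ a<w₁) ℕ.≤-refl E')) a<w₁
      where
      E' : EquivToSubBox T' a w₂
      E' = FitsBox⇒EquivToSubBox (FitsBox-combine (EquivToSubBox⇒FitsBox E) (InBox⇒FitsBox box) w₁≤w₂)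

proposition2p2 : (w₁ w₂ : ℕ) → w₁ ≤ w₂ → (T : Triangle) →
    (InT w₁ w₂ T ⇔ InTlex w₁ w₂ T) × (InTlex w₁ w₂ T ⇔ InTsub w₁ w₂ T)
proposition2p2 w₁ w₂ w₁≤w₂ T =
  ⇔.trans HasWidths⇔LexMinimalFit (⇔.sym InTlex⇔LexMinimalFit) , InTlex⇔InTsub w₁≤w₂
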